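{- There is a constant $C_1>0$ such that for all $r\geq 1$ and all integers $k_1,\dots,k_r\geq 2$, $$\frac{1}{2^{k_1+\cdots+k_r}}<\sum_{n_1\geq\cdots\geq n_r\geq 2}\frac{1}{n_1^{k_1}\cdots n_r^{k_r}}\leq\frac{C_1}{2^{k_1+\cdots+k_r}}$$ and $$\frac{1}{2^{k_1+\cdots+k_r+1}}<\sum_{n_1\geq\cdots\geq n_r\geq n_{r+1}\geq 2}\frac{1}{n_1^{k_1}\cdots n_r^{k_r}\,n_{r+1}}\leq\frac{C_1}{2^{k_1+\cdots+k_r}}.$$ -}

module Defs where

open import Data.Nat as ℕ using (ℕ; zero; suc)
open import Data.Integer using (+_)
open import Data.Rational using (ℚ; _/_; 0ℚ; 1ℚ; _+_; _*_)
open import Data.Vec using (Vec; []; _∷_)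

-- inv n = 1/n as a rational (inv 0 = 0, never used at 0 below)
inv : ℕ → ℚ
inv zero = 0ℚ
inv (suc n) = (+ 1) / suc n

pow : ℚ → ℕ → ℚ
pow q zero = 1ℚ
pow q (suc k) = q * pow q k

Σ₂ : (ℕ → ℚ) → ℕ → ℚ
Σ₂ f zero = 0ℚ
Σ₂ f (suc zero) = 0ℚ
Σ₂ f (suc (suc m)) = Σ₂ f (suc m) + f (suc (suc m))

sumK : ∀ {r} → Vec ℕ r → ℕ
sumK [] = 0
sumK (k ∷ ks) = k ℕ.+ sumK ks

-- Truncated multiple sum:
-- S (k₁,…,k_r) N = Σ_{N ≥ n₁ ≥ ⋯ ≥ n_r ≥ 2} 1/(n₁^k₁ ⋯ n_r^k_r)
S : ∀ {r} → Vec ℕ r → ℕ → ℚ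
S [] N = 1ℚ
S (k ∷ ks) N = Σ₂ (λ n → pow (inv n) k * S ks n) N

-- Truncated sum with an extra index:
-- S′ (k₁,…,k_r) N = Σ_{N ≥ n₁ ≥ ⋯ ≥ n_r ≥ n_{r+1} ≥ 2} 1/(n₁^k₁ ⋯ n_r^k_r n_{r+1})
S′ : ∀ {r} → Vec ℕ r → ℕ → ℚ
S′ [] N = Σ₂ inv N
S′ (k ∷ ks) N = Σ₂ (λ n → pow (inv n) k * S′ ks n) N

-- Since n⁻ᵏ ≤ (4/n²)·2⁻ᵏ for n, k ≥ 2, every summation layer costs a factor 2⁻ᵏ times a
-- weighted sum Σ (4/n²)·g(n). For the envelope g(N) = 6N(N−1)/((N+1)(N+2)) this weighted sum telescopes
-- exactly to g(N), and 1 ≤ g(N) ≤ 6 for N ≥ 2, so induction on the depth gives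
-- S(k₁,…,k_r; N) ≤ g(N)·2^(−Σkᵢ). In the second sum the innermost layer is Σ n⁻ᵏ H_n with
-- H_n = Σ_{2≤m≤n} 1/m; it is at most 4·2⁻ᵏ·Σ H_n/n² ≤ 4·2⁻ᵏ, after which the same induction
-- gives the constant 6·4 = 24. For the lower bounds, the term with all nᵢ = 2 is 2^(−Σkᵢ)
-- (resp. 2^(−Σkᵢ−1)), and truncating at N = 3 instead of 2 adds a positive term.

module Submission where

open import Defs
open import Data.Nat using (ℕ; _≤_; _^_)
open import Data.Rational using (ℚ; 0ℚ; _<_; _*_) renaming (_≤_ to _≤ℚ_)
open import Data.Vec using (Vec)
open import Data.Vec.Relation.Unary.All using (All)
open import Data.Product using (Σ; ∃; _×_)

open import Data.Nat as ℕ using (zero; suc; pred; NonZero)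
import Data.Nat.Properties as ℕ
open import Data.Nat.Tactic.RingSolver using () renaming (solve to solve-ℕ)
open import Data.Integer using (+_)
import Data.Integer as ℤ
import Data.Integer.Properties as ℤ
open import Data.Rational using (1ℚ; ½; _+_; _/_; toℚᵘ; nonNegative; positive)
open import Data.Rational.Properties
import Data.Rational.Unnormalised as ℚᵘ
import Data.Rational.Unnormalised.Properties as ℚᵘ
open import Data.Rational.Solver using (module +-*-Solver)
open import Data.List using ([_])
open import Data.Vec using ([]; _∷_)
open import Data.Vec.Relation.Unary.All using ([]; _∷_)
open import Data.Product using (_,_)
open import Relation.Binary.PropositionalEquality
  using (_≡_; refl; sym; trans; cong; cong₂; subst; subst₂; module ≡-Reasoning)

toℚᵘ-/ : ∀ a b .{{_ : NonZero b}} → toℚᵘ (+ a / b) ℚᵘ.≃ + a ℚᵘ./ b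
toℚᵘ-/ a (suc b) = toℚᵘ-fromℚᵘ (ℚᵘ.mkℚᵘ (+ a) b)

/-mono-≤ : ∀ a b c d .{{_ : NonZero b}} .{{_ : NonZero d}} →
           a ℕ.* d ≤ c ℕ.* b → + a / b ≤ℚ + c / d
/-mono-≤ a b@(suc _) c d@(suc _) ad≤cb = toℚᵘ-cancel-≤
  (ℚᵘ.≤-respˡ-≃ (ℚᵘ.≃-sym (toℚᵘ-/ a b)) (ℚᵘ.≤-respʳ-≃ (ℚᵘ.≃-sym (toℚᵘ-/ c d))
    (ℚᵘ.*≤* (subst₂ ℤ._≤_ (ℤ.pos-* a d) (ℤ.pos-* c b) (ℤ.+≤+ ad≤cb)))))

/-cross : ∀ a b c d .{{_ : NonZero b}} .{{_ : NonZero d}} →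
          a ℕ.* d ≡ c ℕ.* b → + a / b ≡ + c / d
/-cross a b c d ad≡cb =
  ≤-antisym (/-mono-≤ a b c d (ℕ.≤-reflexive ad≡cb)) (/-mono-≤ c d a b (ℕ.≤-reflexive (sym ad≡cb)))

/-* : ∀ a b c d .{{_ : NonZero b}} .{{_ : NonZero d}} →
      (+ a / b) * (+ c / d) ≡ (+ (a ℕ.* c) / (b ℕ.* d)) {{ℕ.m*n≢0 b d}}
/-* a b@(suc _) c d@(suc _) = toℚᵘ-injective (begin
  toℚᵘ (+ a / b * (+ c / d))            ≈⟨ toℚᵘ-homo-* (+ a / b) (+ c / d) ⟩
  toℚᵘ (+ a / b) ℚᵘ.* toℚᵘ (+ c / d)    ≈⟨ ℚᵘ.*-cong (toℚᵘ-/ a b) (toℚᵘ-/ c d) ⟩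
  (+ a ℤ.* + c) ℚᵘ./ (b ℕ.* d)           ≡⟨ cong (ℚᵘ._/ (b ℕ.* d)) (ℤ.pos-* a c) ⟨
  + (a ℕ.* c) ℚᵘ./ (b ℕ.* d)             ≈⟨ toℚᵘ-/ (a ℕ.* c) (b ℕ.* d) ⟨
  toℚᵘ (+ (a ℕ.* c) / (b ℕ.* d))         ∎)
  where open ℚᵘ.≃-Reasoning

/-+ : ∀ a b c d .{{_ : NonZero b}} .{{_ : NonZero d}} →
      (+ a / b) + (+ c / d) ≡ (+ (a ℕ.* d ℕ.+ c ℕ.* b) / (b ℕ.* d)) {{ℕ.m*n≢0 b d}}
/-+ a b@(suc _) c d@(suc _) = toℚᵘ-injective (begin
  toℚᵘ (+ a / b + (+ c / d))                     ≈⟨ toℚᵘ-homo-+ (+ a / b) (+ c / d) ⟩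
  toℚᵘ (+ a / b) ℚᵘ.+ toℚᵘ (+ c / d)             ≈⟨ ℚᵘ.+-cong (toℚᵘ-/ a b) (toℚᵘ-/ c d) ⟩
  (+ a ℤ.* + d ℤ.+ + c ℤ.* + b) ℚᵘ./ (b ℕ.* d)   ≡⟨ cong (ℚᵘ._/ (b ℕ.* d)) numerator ⟨
  + (a ℕ.* d ℕ.+ c ℕ.* b) ℚᵘ./ (b ℕ.* d)         ≈⟨ toℚᵘ-/ (a ℕ.* d ℕ.+ c ℕ.* b) (b ℕ.* d) ⟨
  toℚᵘ (+ (a ℕ.* d ℕ.+ c ℕ.* b) / (b ℕ.* d))     ∎)
  where
  open ℚᵘ.≃-Reasoning
  numerator : + (a ℕ.* d ℕ.+ c ℕ.* b) ≡ + a ℤ.* + d ℤ.+ + c ℤ.* + b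
  numerator = trans (ℤ.pos-+ (a ℕ.* d) (c ℕ.* b)) (cong₂ ℤ._+_ (ℤ.pos-* a d) (ℤ.pos-* c b))

/-+-cross : ∀ a b c d e f .{{_ : NonZero b}} .{{_ : NonZero d}} .{{_ : NonZero f}} →
            (a ℕ.* d ℕ.+ c ℕ.* b) ℕ.* f ≡ e ℕ.* (b ℕ.* d) → + a / b + + c / d ≡ + e / f
/-+-cross a b c d e f eq =
  trans (/-+ a b c d) (/-cross (a ℕ.* d ℕ.+ c ℕ.* b) (b ℕ.* d) e f {{ℕ.m*n≢0 b d}} eq)

p≤p+q : ∀ {p q} → 0ℚ ≤ℚ q → p ≤ℚ p + q
p≤p+q {p} q≥0 = subst (_≤ℚ p + _) (+-identityʳ p) (+-monoʳ-≤ p q≥0)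

p<p+q : ∀ {p q} → 0ℚ < q → p < p + q
p<p+q {p} q>0 = subst (_< p + _) (+-identityʳ p) (+-monoʳ-< p q>0)

*-nonNeg : ∀ {p q} → 0ℚ ≤ℚ p → 0ℚ ≤ℚ q → 0ℚ ≤ℚ p * q
*-nonNeg {p} {q} p≥0 q≥0 =
  nonNegative⁻¹ (p * q) {{nonNeg*nonNeg⇒nonNeg p {{nonNegative p≥0}} q {{nonNegative q≥0}}}}

*-pos : ∀ {p q} → 0ℚ < p → 0ℚ < q → 0ℚ < p * q
*-pos {p} {q} p>0 q>0 = positive⁻¹ (p * q) {{pos*pos⇒pos p {{positive p>0}} q {{positive q>0}}}}

*-mono-≤ : ∀ {p q r s} → 0ℚ ≤ℚ p → 0ℚ ≤ℚ s → p ≤ℚ q → r ≤ℚ s → p * r ≤ℚ q * s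
*-mono-≤ {p} {q} {r} {s} p≥0 s≥0 p≤q r≤s = ≤-trans
  (*-monoˡ-≤-nonNeg p {{nonNegative p≥0}} r≤s) (*-monoʳ-≤-nonNeg s {{nonNegative s≥0}} p≤q)

pow-+ : ∀ p m n → pow p (m ℕ.+ n) ≡ pow p m * pow p n
pow-+ p zero    n = sym (*-identityˡ (pow p n))
pow-+ p (suc m) n = trans (cong (p *_) (pow-+ p m n)) (sym (*-assoc p (pow p m) (pow p n)))

pow-nonNeg : ∀ {p} → 0ℚ ≤ℚ p → ∀ n → 0ℚ ≤ℚ pow p n
pow-nonNeg p≥0 zero    = nonNegative⁻¹ 1ℚ
pow-nonNeg p≥0 (suc n) = *-nonNeg p≥0 (pow-nonNeg p≥0 n)

pow-pos : ∀ {p} → 0ℚ < p → ∀ n → 0ℚ < pow p n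
pow-pos p>0 zero    = positive⁻¹ 1ℚ
pow-pos p>0 (suc n) = *-pos p>0 (pow-pos p>0 n)

pow-mono-≤ : ∀ {p q} → 0ℚ ≤ℚ p → p ≤ℚ q → ∀ n → pow p n ≤ℚ pow q n
pow-mono-≤ p≥0 p≤q zero    = ≤-refl
pow-mono-≤ p≥0 p≤q (suc n) =
  *-mono-≤ p≥0 (pow-nonNeg (≤-trans p≥0 p≤q) n) p≤q (pow-mono-≤ p≥0 p≤q n)

pow-½-nonNeg : ∀ n → 0ℚ ≤ℚ pow ½ n
pow-½-nonNeg = pow-nonNeg (nonNegative⁻¹ ½)

4*pow-½-nonNeg : ∀ n → 0ℚ ≤ℚ + 4 / 1 * pow ½ n
4*pow-½-nonNeg n = *-nonNeg (nonNegative⁻¹ (+ 4 / 1)) (pow-½-nonNeg n)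

inv-pos : ∀ {n} → 1 ≤ n → 0ℚ < inv n
inv-pos {suc n} _ = positive⁻¹ (inv (suc n)) {{normalize-pos 1 (suc n)}}

inv-nonNeg : ∀ n → 0ℚ ≤ℚ inv n
inv-nonNeg zero    = ≤-refl
inv-nonNeg (suc n) = <⇒≤ (inv-pos {suc n} (ℕ.s≤s ℕ.z≤n))

inv-antitone : ∀ {m n} → 1 ≤ m → m ≤ n → inv n ≤ℚ inv m
inv-antitone {suc m} {suc n} _ m≤n =
  /-mono-≤ 1 (suc n) 1 (suc m) (subst₂ _≤_ (sym (ℕ.*-identityˡ _)) (sym (ℕ.*-identityˡ _)) m≤n)

inv-* : ∀ m n .{{_ : NonZero m}} .{{_ : NonZero n}} → inv (m ℕ.* n) ≡ inv m * inv n
inv-* (suc m) (suc n) = sym (/-* 1 (suc m) 1 (suc n))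

inv-2^ : ∀ n → inv (2 ^ n) ≡ pow ½ n
inv-2^ zero    = refl
inv-2^ (suc n) = trans (inv-* 2 (2 ^ n) {{_}} {{ℕ.m^n≢0 2 n}}) (cong (½ *_) (inv-2^ n))

inv-split : ∀ n → inv (suc n) ≡ inv (2 ℕ.+ n) + inv (2 ℕ.+ n) * inv (suc n)
inv-split n = sym (begin
  inv (2 ℕ.+ n) + inv (2 ℕ.+ n) * inv (suc n)
    ≡⟨ cong (λ t → inv (2 ℕ.+ n) + t) (/-* 1 (2 ℕ.+ n) 1 (suc n)) ⟩
  + 1 / (2 ℕ.+ n) + + 1 / ((2 ℕ.+ n) ℕ.* suc n)
    ≡⟨ /-+-cross 1 (2 ℕ.+ n) 1 ((2 ℕ.+ n) ℕ.* suc n) 1 (suc n) (solve-ℕ [ n ]) ⟩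
  inv (suc n) ∎)
  where open ≡-Reasoning

Σ₂-mono-≤ : ∀ {f g} → (∀ n → 2 ≤ n → f n ≤ℚ g n) → ∀ N → Σ₂ f N ≤ℚ Σ₂ g N
Σ₂-mono-≤ f≤g zero          = ≤-refl
Σ₂-mono-≤ f≤g (suc zero)    = ≤-refl
Σ₂-mono-≤ f≤g (suc (suc N)) = +-mono-≤ (Σ₂-mono-≤ f≤g (suc N)) (f≤g (2 ℕ.+ N) (ℕ.m≤m+n 2 N))

Σ₂-nonNeg : ∀ {f} → (∀ n → 2 ≤ n → 0ℚ ≤ℚ f n) → ∀ N → 0ℚ ≤ℚ Σ₂ f N
Σ₂-nonNeg f≥0 zero          = ≤-refl
Σ₂-nonNeg f≥0 (suc zero)    = ≤-refl
Σ₂-nonNeg f≥0 (suc (suc N)) = +-mono-≤ (Σ₂-nonNeg f≥0 (suc N)) (f≥0 (2 ℕ.+ N) (ℕ.m≤m+n 2 N))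

Σ₂-inv-nonNeg : ∀ N → 0ℚ ≤ℚ Σ₂ inv N
Σ₂-inv-nonNeg = Σ₂-nonNeg (λ n _ → inv-nonNeg n)

Σ₂-pos : ∀ {f} → (∀ n → 2 ≤ n → 0ℚ < f n) → ∀ N → 2 ≤ N → 0ℚ < Σ₂ f N
Σ₂-pos f>0 (suc zero) (ℕ.s≤s ())
Σ₂-pos f>0 (suc (suc N)) _ =
  +-mono-≤-< (Σ₂-nonNeg (λ n n≥2 → <⇒≤ (f>0 n n≥2)) (suc N)) (f>0 (2 ℕ.+ N) (ℕ.m≤m+n 2 N))

Σ₂-*ʳ : ∀ f c N → Σ₂ (λ n → f n * c) N ≡ Σ₂ f N * c
Σ₂-*ʳ f c zero          = sym (*-zeroˡ c)
Σ₂-*ʳ f c (suc zero)    = sym (*-zeroˡ c)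
Σ₂-*ʳ f c (suc (suc N)) = trans (cong (_+ f (2 ℕ.+ N) * c) (Σ₂-*ʳ f c (suc N)))
                                 (sym (*-distribʳ-+ c (Σ₂ f (suc N)) (f (2 ℕ.+ N))))

Σ₂-≤-from-2 : ∀ {f c} → 0ℚ ≤ℚ c → (∀ N → 2 ≤ N → Σ₂ f N ≤ℚ c) → ∀ N → Σ₂ f N ≤ℚ c
Σ₂-≤-from-2 c≥0 bound zero          = c≥0
Σ₂-≤-from-2 c≥0 bound (suc zero)    = c≥0
Σ₂-≤-from-2 c≥0 bound (suc (suc N)) = bound (2 ℕ.+ N) (ℕ.m≤m+n 2 N)

weight : ℕ → ℚ
weight n = + 4 / 1 * (inv n * inv n)

-- For n ≥ 2, envelope n = ∏_{m=3}^{n} m²/((m−2)(m+2)), hence envelope (n−1) = (1 − 4/n²)·envelope n.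
envelope : ℕ → ℚ
envelope n = + (6 ℕ.* n ℕ.* pred n) / (suc n ℕ.* suc (suc n))

weight-/ : ∀ n → weight (suc n) ≡ + 4 / (suc n ℕ.* suc n)
weight-/ n = begin
  + 4 / 1 * (inv (suc n) * inv (suc n))   ≡⟨ cong (+ 4 / 1 *_) (/-* 1 (suc n) 1 (suc n)) ⟩
  + 4 / 1 * (+ 1 / (suc n ℕ.* suc n))     ≡⟨ /-* 4 1 1 (suc n ℕ.* suc n) ⟩
  + 4 / (1 ℕ.* (suc n ℕ.* suc n))         ≡⟨ /-cross 4 (1 ℕ.* (suc n ℕ.* suc n)) 4 (suc n ℕ.* suc n)
                                                       (solve-ℕ [ n ]) ⟩
  + 4 / (suc n ℕ.* suc n)                 ∎
  where open ≡-Reasoning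

weight-* : ∀ n a b .{{_ : NonZero b}} → weight (suc n) * (+ a / b) ≡
           (+ (4 ℕ.* a) / (suc n ℕ.* suc n ℕ.* b)) {{ℕ.m*n≢0 (suc n ℕ.* suc n) b}}
weight-* n a b = trans (cong (_* (+ a / b)) (weight-/ n)) (/-* 4 (suc n ℕ.* suc n) a b)

envelope-step : ∀ m → envelope (suc m) + weight (2 ℕ.+ m) * envelope (2 ℕ.+ m) ≡ envelope (2 ℕ.+ m)
envelope-step m =
  -- let rather than where: the ring solver does not unfold where-bound names.
  let n = 2 ℕ.+ m
      e = 6 ℕ.* n ℕ.* suc m
      f = suc n ℕ.* suc (suc n)
  in trans (cong (λ t → envelope (suc m) + t) (weight-* (suc m) e f))
           (/-+-cross (6 ℕ.* suc m ℕ.* m) (n ℕ.* suc n) (4 ℕ.* e) (n ℕ.* n ℕ.* f) e f (solve-ℕ [ m ]))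

Σ₂-weight-envelope : ∀ N → Σ₂ (λ n → weight n * envelope n) N ≡ envelope N
Σ₂-weight-envelope zero          = refl
Σ₂-weight-envelope (suc zero)    = refl
Σ₂-weight-envelope (suc (suc N)) =
  trans (cong (_+ weight (2 ℕ.+ N) * envelope (2 ℕ.+ N)) (Σ₂-weight-envelope (suc N))) (envelope-step N)

envelope-nonNeg : ∀ n → 0ℚ ≤ℚ envelope n
envelope-nonNeg n = /-mono-≤ 0 1 (6 ℕ.* n ℕ.* pred n) (suc n ℕ.* suc (suc n)) ℕ.z≤n

envelope-≤-6 : ∀ n → envelope n ≤ℚ + 6 / 1
envelope-≤-6 zero    = /-mono-≤ 0 2 6 1 ℕ.z≤n
envelope-≤-6 (suc m) = /-mono-≤ (6 ℕ.* suc m ℕ.* m) ((2 ℕ.+ m) ℕ.* (3 ℕ.+ m)) 6 1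
  (ℕ.m+n≤o⇒m≤o _ {24 ℕ.* m ℕ.+ 36} (ℕ.≤-reflexive (solve-ℕ [ m ])))

envelope-≥-1 : ∀ {n} → 2 ≤ n → 1ℚ ≤ℚ envelope n
envelope-≥-1 {suc zero} (ℕ.s≤s ())
envelope-≥-1 {suc (suc m)} _ = /-mono-≤ 1 1 (6 ℕ.* (2 ℕ.+ m) ℕ.* suc m) ((3 ℕ.+ m) ℕ.* (4 ℕ.+ m))
  (ℕ.m+n≤o⇒m≤o _ {5 ℕ.* m ℕ.* m ℕ.+ 11 ℕ.* m} (ℕ.≤-reflexive (solve-ℕ [ m ])))

≤-envelope-* : ∀ {n c} → 2 ≤ n → 0ℚ ≤ℚ c → c ≤ℚ envelope n * c
≤-envelope-* {n} {c} n≥2 c≥0 =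
  subst (_≤ℚ envelope n * c) (*-identityˡ c) (*-monoʳ-≤-nonNeg c {{nonNegative c≥0}} (envelope-≥-1 n≥2))

pow-inv-≤ : ∀ {k n} → 2 ≤ k → 2 ≤ n → pow (inv n) k ≤ℚ weight n * pow ½ k
pow-inv-≤ {suc zero}    (ℕ.s≤s ()) _
pow-inv-≤ {suc (suc k)} {n} _ n≥2 = begin
  x * (x * pow x k)
    ≤⟨ *-mono-≤ x≥0 (*-nonNeg x≥0 ½ᵏ≥0) ≤-refl (*-mono-≤ x≥0 ½ᵏ≥0 ≤-refl xᵏ≤½ᵏ) ⟩
  x * (x * pow ½ k)
    ≡⟨ *-identityˡ _ ⟨
  1ℚ * (x * (x * pow ½ k))
    ≡⟨⟩
  + 4 / 1 * ½ * ½ * (x * (x * pow ½ k))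
    ≡⟨ solve 4 (λ f y h p → f :* h :* h :* (y :* (y :* p)) := f :* (y :* y) :* (h :* (h :* p))) refl
               (+ 4 / 1) x ½ (pow ½ k) ⟩
  + 4 / 1 * (x * x) * (½ * (½ * pow ½ k))
    ∎
  where
  open ≤-Reasoning
  open +-*-Solver
  x : ℚ
  x = inv n
  x≥0 : 0ℚ ≤ℚ x
  x≥0 = inv-nonNeg n
  ½ᵏ≥0 : 0ℚ ≤ℚ pow ½ k
  ½ᵏ≥0 = pow-½-nonNeg k
  xᵏ≤½ᵏ : pow x k ≤ℚ pow ½ k
  xᵏ≤½ᵏ = pow-mono-≤ x≥0 (inv-antitone (ℕ.s≤s ℕ.z≤n) n≥2) k

Σ₂-pow-inv-≤ : ∀ {k c} {F : ℕ → ℚ} → 2 ≤ k → 0ℚ ≤ℚ c →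
               (∀ n → 2 ≤ n → F n ≤ℚ envelope n * c) →
               ∀ N → Σ₂ (λ n → pow (inv n) k * F n) N ≤ℚ envelope N * (pow ½ k * c)
Σ₂-pow-inv-≤ {k} {c} {F} k≥2 c≥0 F≤ N = begin
  Σ₂ (λ n → pow (inv n) k * F n) N                      ≤⟨ Σ₂-mono-≤ termwise N ⟩
  Σ₂ (λ n → weight n * envelope n * (pow ½ k * c)) N    ≡⟨ Σ₂-*ʳ (λ n → weight n * envelope n) _ N ⟩
  Σ₂ (λ n → weight n * envelope n) N * (pow ½ k * c)    ≡⟨ cong (_* (pow ½ k * c)) (Σ₂-weight-envelope N) ⟩
  envelope N * (pow ½ k * c)                            ∎
  where
  open ≤-Reasoning
  termwise : ∀ n → 2 ≤ n → pow (inv n) k * F n ≤ℚ weight n * envelope n * (pow ½ k * c)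
  termwise n n≥2 = begin
    pow (inv n) k * F n                       ≤⟨ *-mono-≤ (pow-nonNeg (inv-nonNeg n) k)
                                                          (*-nonNeg (envelope-nonNeg n) c≥0)
                                                          (pow-inv-≤ k≥2 n≥2) (F≤ n n≥2) ⟩
    weight n * pow ½ k * (envelope n * c)     ≡⟨ solve 4 (λ w p e c → w :* p :* (e :* c) := w :* e :* (p :* c)) refl
                                                         (weight n) (pow ½ k) (envelope n) c ⟩
    weight n * envelope n * (pow ½ k * c)     ∎
    where open +-*-Solver

geometric-≤ : ∀ {a b} → 0ℚ ≤ℚ a → 0ℚ ≤ℚ b → b ≡ a + a * b → a + a * a + a * a * a ≤ℚ b
geometric-≤ {a} {b} a≥0 b≥0 b≡a+ab = begin
  a + a * a + a * a * a                        ≤⟨ p≤p+q (*-nonNeg (*-nonNeg (*-nonNeg a≥0 a≥0) a≥0) b≥0) ⟩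
  a + a * a + a * a * a + a * a * a * b        ≡⟨ solve 2 (λ a b → a :+ a :* a :+ a :* a :* a :+ a :* a :* a :* b
                                                          := a :+ a :* (a :+ a :* (a :+ a :* b))) refl a b ⟩
  a + a * (a + a * (a + a * b))                ≡⟨ cong (λ t → a + a * (a + a * t)) b≡a+ab ⟨
  a + a * (a + a * b)                          ≡⟨ cong (λ t → a + a * t) b≡a+ab ⟨
  a + a * b                                    ≡⟨ b≡a+ab ⟨
  b                                            ∎
  where
  open ≤-Reasoning
  open +-*-Solver

harmonic-step : ∀ {a b x} → 0ℚ ≤ℚ a → 0ℚ ≤ℚ x → a + a * a + a * a * a ≤ℚ b →
                a * a * (x + a) + (1ℚ + (x + a)) * a ≤ℚ (1ℚ + x) * b
harmonic-step {a} {b} {x} a≥0 x≥0 geometric = begin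
  a * a * (x + a) + (1ℚ + (x + a)) * a
    ≤⟨ p≤p+q (*-nonNeg (*-nonNeg (*-nonNeg a≥0 a≥0) a≥0) x≥0) ⟩
  a * a * (x + a) + (1ℚ + (x + a)) * a + a * a * a * x
    ≡⟨ solve 2 (λ a x → a :* a :* (x :+ a) :+ (con 1ℚ :+ (x :+ a)) :* a :+ a :* a :* a :* x
                        := (con 1ℚ :+ x) :* (a :+ a :* a :+ a :* a :* a)) refl a x ⟩
  (1ℚ + x) * (a + a * a + a * a * a)
    ≤⟨ *-monoˡ-≤-nonNeg (1ℚ + x) {{nonNegative 1+x≥0}} geometric ⟩
  (1ℚ + x) * b
    ∎
  where
  open ≤-Reasoning
  open +-*-Solver
  1+x≥0 : 0ℚ ≤ℚ 1ℚ + x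
  1+x≥0 = +-mono-≤ (nonNegative⁻¹ 1ℚ) x≥0

-- (1 + H_N)/N with H_N = Σ₂ inv N is a potential: the next term H_{N+1}/(N+1)² costs at most
-- its decrease, by geometric-≤ with a = 1/(N+1) and b = 1/N = a + a·b.
harmonic-invariant : ∀ N → Σ₂ (λ n → inv n * inv n * Σ₂ inv n) N + (1ℚ + Σ₂ inv N) * inv N ≤ℚ 1ℚ
harmonic-invariant zero          = nonNegative⁻¹ 1ℚ
harmonic-invariant (suc zero)    = ≤-refl
harmonic-invariant (suc (suc n)) = begin
  Σ₂ f (suc n) + a * a * (x + a) + (1ℚ + (x + a)) * a     ≡⟨ +-assoc (Σ₂ f (suc n)) _ _ ⟩
  Σ₂ f (suc n) + (a * a * (x + a) + (1ℚ + (x + a)) * a)   ≤⟨ +-monoʳ-≤ (Σ₂ f (suc n)) (harmonic-step a≥0 x≥0 a+a²+a³≤b) ⟩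
  Σ₂ f (suc n) + (1ℚ + x) * inv (suc n)                   ≤⟨ harmonic-invariant (suc n) ⟩
  1ℚ                                                      ∎
  where
  open ≤-Reasoning
  f : ℕ → ℚ
  f m = inv m * inv m * Σ₂ inv m
  a x : ℚ
  a = inv (2 ℕ.+ n)
  x = Σ₂ inv (suc n)
  a≥0 : 0ℚ ≤ℚ a
  a≥0 = inv-nonNeg (2 ℕ.+ n)
  x≥0 : 0ℚ ≤ℚ x
  x≥0 = Σ₂-inv-nonNeg (suc n)
  a+a²+a³≤b : a + a * a + a * a * a ≤ℚ inv (suc n)
  a+a²+a³≤b = geometric-≤ a≥0 (inv-nonNeg (suc n)) (inv-split n)

Σ₂-inv²-harmonic-≤-1 : ∀ N → Σ₂ (λ n → inv n * inv n * Σ₂ inv n) N ≤ℚ 1ℚ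
Σ₂-inv²-harmonic-≤-1 N = ≤-trans (p≤p+q (*-nonNeg 1+H≥0 (inv-nonNeg N))) (harmonic-invariant N)
  where
  1+H≥0 : 0ℚ ≤ℚ 1ℚ + Σ₂ inv N
  1+H≥0 = +-mono-≤ (nonNegative⁻¹ 1ℚ) (Σ₂-inv-nonNeg N)

S′-single-≤ : ∀ {k} → 2 ≤ k → ∀ N → S′ (k ∷ []) N ≤ℚ + 4 / 1 * pow ½ k
S′-single-≤ {k} k≥2 N = begin
  Σ₂ (λ n → pow (inv n) k * Σ₂ inv n) N            ≤⟨ Σ₂-mono-≤ termwise N ⟩
  Σ₂ (λ n → inv n * inv n * Σ₂ inv n * c) N        ≡⟨ Σ₂-*ʳ (λ n → inv n * inv n * Σ₂ inv n) c N ⟩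
  Σ₂ (λ n → inv n * inv n * Σ₂ inv n) N * c        ≤⟨ *-monoʳ-≤-nonNeg c {{nonNegative c≥0}}
                                                                        (Σ₂-inv²-harmonic-≤-1 N) ⟩
  1ℚ * c                                           ≡⟨ *-identityˡ c ⟩
  c                                                ∎
  where
  open ≤-Reasoning
  c : ℚ
  c = + 4 / 1 * pow ½ k
  c≥0 : 0ℚ ≤ℚ c
  c≥0 = 4*pow-½-nonNeg k
  termwise : ∀ n → 2 ≤ n → pow (inv n) k * Σ₂ inv n ≤ℚ inv n * inv n * Σ₂ inv n * c
  termwise n n≥2 = begin
    pow (inv n) k * Σ₂ inv n
      ≤⟨ *-monoʳ-≤-nonNeg (Σ₂ inv n) {{nonNegative (Σ₂-inv-nonNeg n)}} (pow-inv-≤ k≥2 n≥2) ⟩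
    + 4 / 1 * (inv n * inv n) * pow ½ k * Σ₂ inv n
      ≡⟨ solve 4 (λ f x p h → f :* (x :* x) :* p :* h := x :* x :* h :* (f :* p)) refl
                 (+ 4 / 1) (inv n) (pow ½ k) (Σ₂ inv n) ⟩
    inv n * inv n * Σ₂ inv n * c
      ∎
    where open +-*-Solver

S-≤ : ∀ {r} {ks : Vec ℕ r} → All (λ kᵢ → 2 ≤ kᵢ) ks →
      ∀ n → 2 ≤ n → S ks n ≤ℚ envelope n * pow ½ (sumK ks)
S-≤ [] n n≥2 = ≤-envelope-* n≥2 (nonNegative⁻¹ 1ℚ)
S-≤ {ks = k ∷ ks} (k≥2 ∷ ks≥2) n _ =
  subst (λ t → S (k ∷ ks) n ≤ℚ envelope n * t) (sym (pow-+ ½ k (sumK ks)))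
        (Σ₂-pow-inv-≤ k≥2 (pow-½-nonNeg (sumK ks)) (S-≤ ks≥2) n)

S′-≤ : ∀ {r k} {ks : Vec ℕ r} → 2 ≤ k → All (λ kᵢ → 2 ≤ kᵢ) ks →
       ∀ n → 2 ≤ n → S′ (k ∷ ks) n ≤ℚ envelope n * (+ 4 / 1 * pow ½ (sumK (k ∷ ks)))
S′-≤ {k = k} k≥2 [] n n≥2 = begin
  S′ (k ∷ []) n                                ≤⟨ S′-single-≤ k≥2 n ⟩
  + 4 / 1 * pow ½ k                            ≡⟨ cong (λ t → + 4 / 1 * pow ½ t) (ℕ.+-identityʳ k) ⟨
  + 4 / 1 * pow ½ (k ℕ.+ 0)                    ≤⟨ ≤-envelope-* n≥2 (4*pow-½-nonNeg (k ℕ.+ 0)) ⟩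
  envelope n * (+ 4 / 1 * pow ½ (k ℕ.+ 0))     ∎
  where open ≤-Reasoning
S′-≤ {k = k} {k′ ∷ ks} k≥2 (k′≥2 ∷ ks≥2) n _ = begin
  S′ (k ∷ k′ ∷ ks) n                             ≤⟨ Σ₂-pow-inv-≤ k≥2 (4*pow-½-nonNeg K′)
                                                                  (S′-≤ k′≥2 ks≥2) n ⟩
  envelope n * (pow ½ k * (+ 4 / 1 * pow ½ K′))
    ≡⟨ cong (envelope n *_) (solve 3 (λ p f q → p :* (f :* q) := f :* (p :* q)) refl (pow ½ k) (+ 4 / 1) (pow ½ K′)) ⟩
  envelope n * (+ 4 / 1 * (pow ½ k * pow ½ K′))  ≡⟨ cong (λ t → envelope n * (+ 4 / 1 * t)) (pow-+ ½ k K′) ⟨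
  envelope n * (+ 4 / 1 * pow ½ (k ℕ.+ K′))      ∎
  where
  open ≤-Reasoning
  open +-*-Solver
  K′ : ℕ
  K′ = sumK (k′ ∷ ks)

S-at-2 : ∀ {r} (ks : Vec ℕ r) → S ks 2 ≡ pow ½ (sumK ks)
S-at-2 []       = refl
S-at-2 (k ∷ ks) = trans (+-identityˡ _) (trans (cong (pow ½ k *_) (S-at-2 ks)) (sym (pow-+ ½ k (sumK ks))))

S′-at-2 : ∀ {r} (ks : Vec ℕ r) → S′ ks 2 ≡ pow ½ (sumK ks ℕ.+ 1)
S′-at-2 []       = refl
S′-at-2 (k ∷ ks) = trans (+-identityˡ _) (trans (cong (pow ½ k *_) (S′-at-2 ks))
  (trans (sym (pow-+ ½ k (sumK ks ℕ.+ 1))) (cong (pow ½) (sym (ℕ.+-assoc k (sumK ks) 1)))))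

S-pos : ∀ {r} (ks : Vec ℕ r) n → 2 ≤ n → 0ℚ < S ks n
S-pos []       n n≥2 = positive⁻¹ 1ℚ
S-pos (k ∷ ks) n n≥2 =
  Σ₂-pos (λ m m≥2 → *-pos (pow-pos (inv-pos (ℕ.<⇒≤ m≥2)) k) (S-pos ks m m≥2)) n n≥2

S′-pos : ∀ {r} (ks : Vec ℕ r) n → 2 ≤ n → 0ℚ < S′ ks n
S′-pos []       n n≥2 = Σ₂-pos (λ m m≥2 → inv-pos (ℕ.<⇒≤ m≥2)) n n≥2
S′-pos (k ∷ ks) n n≥2 =
  Σ₂-pos (λ m m≥2 → *-pos (pow-pos (inv-pos (ℕ.<⇒≤ m≥2)) k) (S′-pos ks m m≥2)) n n≥2

S-lower : ∀ {r} k (ks : Vec ℕ r) → inv (2 ^ sumK (k ∷ ks)) < S (k ∷ ks) 3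
S-lower k ks = begin-strict
  inv (2 ^ sumK (k ∷ ks))   ≡⟨ inv-2^ (sumK (k ∷ ks)) ⟩
  pow ½ (sumK (k ∷ ks))     ≡⟨ S-at-2 (k ∷ ks) ⟨
  S (k ∷ ks) 2              <⟨ p<p+q (*-pos (pow-pos (inv-pos {3} (ℕ.m≤m+n 1 2)) k) (S-pos ks 3 (ℕ.m≤m+n 2 1))) ⟩
  S (k ∷ ks) 3              ∎
  where open ≤-Reasoning

S′-lower : ∀ {r} k (ks : Vec ℕ r) → inv (2 ^ (sumK (k ∷ ks) ℕ.+ 1)) < S′ (k ∷ ks) 3
S′-lower k ks = begin-strict
  inv (2 ^ (sumK (k ∷ ks) ℕ.+ 1))   ≡⟨ inv-2^ (sumK (k ∷ ks) ℕ.+ 1) ⟩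
  pow ½ (sumK (k ∷ ks) ℕ.+ 1)       ≡⟨ S′-at-2 (k ∷ ks) ⟨
  S′ (k ∷ ks) 2                     <⟨ p<p+q (*-pos (pow-pos (inv-pos {3} (ℕ.m≤m+n 1 2)) k) (S′-pos ks 3 (ℕ.m≤m+n 2 1))) ⟩
  S′ (k ∷ ks) 3                     ∎
  where open ≤-Reasoning

C : ℚ
C = + 24 / 1

S-upper : ∀ {r k} {ks : Vec ℕ r} → 2 ≤ k → All (λ kᵢ → 2 ≤ kᵢ) ks →
          ∀ N → S (k ∷ ks) N ≤ℚ C * inv (2 ^ sumK (k ∷ ks))
S-upper {k = k} {ks} k≥2 ks≥2 = Σ₂-≤-from-2 (*-nonNeg (nonNegative⁻¹ C) (inv-nonNeg (2 ^ K))) bound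
  where
  open ≤-Reasoning
  K : ℕ
  K = sumK (k ∷ ks)
  6≤C : + 6 / 1 ≤ℚ C
  6≤C = /-mono-≤ 6 1 24 1 (ℕ.m≤m+n 6 18)
  bound : ∀ n → 2 ≤ n → S (k ∷ ks) n ≤ℚ C * inv (2 ^ K)
  bound n n≥2 = begin
    S (k ∷ ks) n           ≤⟨ S-≤ (k≥2 ∷ ks≥2) n n≥2 ⟩
    envelope n * pow ½ K   ≤⟨ *-monoʳ-≤-nonNeg (pow ½ K) {{nonNegative (pow-½-nonNeg K)}}
                                                (≤-trans (envelope-≤-6 n) 6≤C) ⟩
    C * pow ½ K            ≡⟨ cong (C *_) (inv-2^ K) ⟨
    C * inv (2 ^ K)        ∎

S′-upper : ∀ {r k} {ks : Vec ℕ r} → 2 ≤ k → All (λ kᵢ → 2 ≤ kᵢ) ks →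
           ∀ N → S′ (k ∷ ks) N ≤ℚ C * inv (2 ^ sumK (k ∷ ks))
S′-upper {k = k} {ks} k≥2 ks≥2 = Σ₂-≤-from-2 (*-nonNeg (nonNegative⁻¹ C) (inv-nonNeg (2 ^ K))) bound
  where
  open ≤-Reasoning
  K : ℕ
  K = sumK (k ∷ ks)
  bound : ∀ n → 2 ≤ n → S′ (k ∷ ks) n ≤ℚ C * inv (2 ^ K)
  bound n n≥2 = begin
    S′ (k ∷ ks) n                      ≤⟨ S′-≤ k≥2 ks≥2 n n≥2 ⟩
    envelope n * (+ 4 / 1 * pow ½ K)   ≤⟨ *-monoʳ-≤-nonNeg (+ 4 / 1 * pow ½ K) {{nonNegative (4*pow-½-nonNeg K)}}
                                                            (envelope-≤-6 n) ⟩
    + 6 / 1 * (+ 4 / 1 * pow ½ K)      ≡⟨ *-assoc (+ 6 / 1) (+ 4 / 1) (pow ½ K) ⟨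
    C * pow ½ K                        ≡⟨ cong (C *_) (inv-2^ K) ⟨
    C * inv (2 ^ K)                    ∎

lemma4p3 : Σ ℚ λ C₁ → 0ℚ < C₁ ×
    ((r : ℕ) → 1 ≤ r → (k : Vec ℕ r) → All (λ kᵢ → 2 ≤ kᵢ) k →
      ((∃ λ N → inv (2 ^ sumK k) < S k N) × (∀ N → S k N ≤ℚ C₁ * inv (2 ^ sumK k)))
      × ((∃ λ N → inv (2 ^ (sumK k Data.Nat.+ 1)) < S′ k N) × (∀ N → S′ k N ≤ℚ C₁ * inv (2 ^ sumK k))))
lemma4p3 = C , positive⁻¹ C , λ where
  (suc _) _ (k ∷ ks) (k≥2 ∷ ks≥2) →
    ((3 , S-lower k ks) , S-upper k≥2 ks≥2) , ((3 , S′-lower k ks) , S′-upper k≥2 ks≥2)
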